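{- Let $\langle W,R,\mathrm{Val}\rangle$ be a weak non standard $n+1$-valued Kripke model, let $\phi$ be a formula, and let $E\subseteq W$ be $\equiv_\phi$-saturated (i.e., $E$ contains the $\equiv_\phi$-class of each of its elements). Then there is a formula $\Psi_E$ such that $E=\{u\in W:\mathrm{Val}(u,\Psi_E)=1\}$.
   Context: Language: nonempty $\Pi_0$ of atomic programs, countable $\mathsf{Prop}$; formulas $\phi::=p\mid0\mid\neg\phi\mid\phi\to\phi\mid[\alpha]\phi$, programs $\alpha::=a\mid\phi?\mid\alpha;\alpha\mid\alpha\cup\alpha\mid\alpha^*$; $\Pi$ the set of programs. $\mathrm{L}_n=\{i/n:0\le i\le n\}$ with $\neg x=1-x$, $x\to y=\min(1-x+y,1)$. A weak non standard $n+1$-valued Kripke model $\langle W,R,\mathrm{Val}\rangle$: nonempty set $W$, a relation $R_\alpha\subseteq W\times W$ for every $\alpha\in\Pi$, and $\mathrm{Val}:W\times\mathsf{Prop}\to\mathrm{L}_n$ extended by $\mathrm{Val}(w,0)=0$, $\mathrm{Val}(w,\phi\to\psi)=\mathrm{Val}(w,\phi)\to\mathrm{Val}(w,\psi)$, $\mathrm{Val}(w,\neg\psi)=1-\mathrm{Val}(w,\psi)$, $\mathrm{Val}(w,[\alpha]\psi)=\bigwedge\{\mathrm{Val}(v,\psi):(w,v)\in R_\alpha\}$ (empty infimum $=1$). The Fischer–Ladner closure $FL(\phi)$ is the smallest set $Y$ of formulas with $\phi\in Y$ and: $\chi\in Y$ if $\neg\chi\in Y$; $\chi,\theta\in Y$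 if $\chi\to\theta\in Y$; $\chi\in Y$ if $[\alpha]\chi\in Y$; $[\alpha][\beta]\chi\in Y$ if $[\alpha;\beta]\chi\in Y$; $[\alpha]\chi,[\beta]\chi\in Y$ if $[\alpha\cup\beta]\chi\in Y$; $[\alpha][\alpha^*]\chi\in Y$ if $[\alpha^*]\chi\in Y$; $\theta,\chi\in Y$ if $[\theta?]\chi\in Y$. The relation $u\equiv_\phi v$ holds iff $\mathrm{Val}(u,\psi)=\mathrm{Val}(v,\psi)$ for all $\psi\in FL(\phi)$. -}

module Defs where

open import Data.Nat as ℕ using (ℕ; _∸_; _+_; _⊓_)
open import Data.Fin as Fin using (Fin; toℕ; fromℕ; _≤_)
open import Data.Product using (_×_)
open import Relation.Binary.PropositionalEquality using (_≡_)

-- Prop = ℕ (countable set of propositional variables); Π₀ = the type A of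
-- atomic programs (its nonemptiness is a hypothesis of the theorem).
module _ (A : Set) where
  mutual
    data Fm : Set where
      var  : ℕ → Fm
      fals : Fm
      neg  : Fm → Fm
      _⇒_  : Fm → Fm → Fm
      box  : Pg → Fm → Fm

    data Pg : Set where
      atom : A → Pg
      test : Fm → Pg
      _⨾_  : Pg → Pg → Pg
      _∪_  : Pg → Pg → Pg
      star : Pg → Pg

module _ {A : Set} where
  data FL (φ : Fm A) : Fm A → Set where
    fl-self : FL φ φ
    fl-neg  : ∀ {χ} → FL φ (neg χ) → FL φ χ
    fl-impl : ∀ {χ θ} → FL φ (χ ⇒ θ) → FL φ χ
    fl-impr : ∀ {χ θ} → FL φ (χ ⇒ θ) → FL φ θ
    fl-box  : ∀ {α χ} → FL φ (box α χ) → FL φ χ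
    fl-seq  : ∀ {α β χ} → FL φ (box (α ⨾ β) χ) → FL φ (box α (box β χ))
    fl-unl  : ∀ {α β χ} → FL φ (box (α ∪ β) χ) → FL φ (box α χ)
    fl-unr  : ∀ {α β χ} → FL φ (box (α ∪ β) χ) → FL φ (box β χ)
    fl-star : ∀ {α χ} → FL φ (box (star α) χ) → FL φ (box α (box (star α) χ))
    fl-tst1 : ∀ {θ χ} → FL φ (box (test θ) χ) → FL φ θ
    fl-tst2 : ∀ {θ χ} → FL φ (box (test θ) χ) → FL φ χ

-- Truth values L_n = {i/n : 0 ≤ i ≤ n} are represented by i : Fin (suc n).
-- A weak non standard (n+1)-valued Kripke model: W, a relation R α for EVERY
-- program α (no constraints), and Val extended to all formulas, subject to
-- the clauses of the definition (the [α]-clause says Val(w,[α]ψ) is the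
-- infimum of {Val(v,ψ) : w R_α v}; empty infimum = 1 follows from this).
record Model (A : Set) (n : ℕ) : Set₁ where
  field
    W   : Set
    R   : Pg A → W → W → Set
    Val : W → Fm A → Fin (ℕ.suc n)
    val-0   : ∀ w → Val w (fals {A}) ≡ Fin.zero
    val-neg : ∀ w ψ → toℕ (Val w (neg ψ)) ≡ n ∸ toℕ (Val w ψ)
    val-imp : ∀ w ψ χ →
      toℕ (Val w (ψ ⇒ χ)) ≡ (n ∸ toℕ (Val w ψ) + toℕ (Val w χ)) ⊓ n
    val-box-lb  : ∀ w α ψ v → R α w v → Val w (box α ψ) ≤ Val v ψ
    val-box-glb : ∀ w α ψ (b : Fin (ℕ.suc n)) →
      (∀ v → R α w v → b ≤ Val v ψ) → b ≤ Val w (box α ψ)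

  _≡[_]_ : W → Fm A → W → Set
  u ≡[ φ ] v = ∀ ψ → FL φ ψ → Val u ψ ≡ Val v ψ

  Saturated : Fm A → (W → Set) → Set
  Saturated φ E = ∀ u v → E u → u ≡[ φ ] v → E v

module Submission where

-- Let L be a finite list of formulas containing FL(φ).  A set
-- E that is saturated for agreement on L is a finite union of "agreement
-- classes", and each class is cut out by the truth values of the formulas
-- of L.  Two facts make this expressible by a formula:
--   * FL(φ) is contained in an explicit finite list closure φ
--     (module FiniteClosure);
--   * in the (n+1)-valued Łukasiewicz logic every statement "x has value c"
--     is definable from x using 0, ¬ and → alone (module Łukasiewicz).  The
--     heart of this is the definability of the thresholds "x ≥ k", obtained
--     by well-founded recursion on k from truncated multiplication m·x, its
--     dual ¬(m·¬x) and Euclidean division (module ScaledChain).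
-- Module Definability then shows, by induction on L, that every set
-- saturated for agreement on L is definable: split E according to the value
-- c of the head formula ψ and define each piece by induction; the base case
-- L = [] asks whether E is empty, which is where excluded middle is used.
-- The theorem is this statement for L = closure φ.

open import Defs
open import Axiom.ExcludedMiddle using (ExcludedMiddle)
open import Data.Fin using (Fin; toℕ; fromℕ; zero; suc)
open import Data.Fin.Properties using (toℕ≤pred[n]; toℕ-injective; toℕ-fromℕ)
open import Data.List using (List; []; _∷_; _++_)
open import Data.List.Membership.Propositional using (_∈_)
open import Data.List.Membership.Propositional.Properties using (∈-++⁺ˡ; ∈-++⁺ʳ; ∈-++⁻)
open import Data.List.Properties using (++-assoc)
open import Data.List.Relation.Binary.Subset.Propositional.Properties
  using (xs⊆xs++ys; ++⁺ˡ)
open import Data.List.Relation.Unary.Any using (here; there)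
open import Data.Nat
open import Data.Nat.DivMod using (_/_; _%_; m/n*n≤m; m%n<n; m≡m%n+[m/n]*n; m≥n⇒m/n>0)
open import Data.Nat.Induction using (<-rec)
open import Data.Nat.Properties
open import Data.Product using (Σ; ∃; _×_; _,_; proj₁; proj₂)
import Data.Product.Function.Dependent.Propositional as Σ
open import Data.Product.Function.NonDependent.Propositional using (_×-⇔_)
open import Data.Sum using (_⊎_; inj₁; inj₂)
open import Function using (_∘_; const)
open import Function.Bundles using (_⇔_; mk⇔; Equivalence)
open import Function.Properties.Equivalence using () renaming (sym to ⇔-sym)
import Function.Related.Propositional as Related
open import Level using (0ℓ)
open import Relation.Binary.PropositionalEquality
open import Relation.Nullary using (¬_; yes; no; contradiction)

module FiniteClosure {A : Set} where

  data _↝_ : Fm A → Fm A → Set where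
    ↝-neg  : ∀ {χ} → neg χ ↝ χ
    ↝-impl : ∀ {χ θ} → (χ ⇒ θ) ↝ χ
    ↝-impr : ∀ {χ θ} → (χ ⇒ θ) ↝ θ
    ↝-box  : ∀ {α χ} → box α χ ↝ χ
    ↝-seq  : ∀ {α β χ} → box (α ⨾ β) χ ↝ box α (box β χ)
    ↝-unl  : ∀ {α β χ} → box (α ∪ β) χ ↝ box α χ
    ↝-unr  : ∀ {α β χ} → box (α ∪ β) χ ↝ box β χ
    ↝-star : ∀ {α χ} → box (star α) χ ↝ box α (box (star α) χ)
    ↝-tst1 : ∀ {θ χ} → box (test θ) χ ↝ θ
    ↝-tst2 : ∀ {θ χ} → box (test θ) χ ↝ χ

  FL-least : ∀ {φ} (P : Fm A → Set) → P φ →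
             (∀ {ψ χ} → P ψ → ψ ↝ χ → P χ) → ∀ {ψ} → FL φ ψ → P ψ
  FL-least P base step fl-self     = base
  FL-least P base step (fl-neg p)  = step (FL-least P base step p) ↝-neg
  FL-least P base step (fl-impl p) = step (FL-least P base step p) ↝-impl
  FL-least P base step (fl-impr p) = step (FL-least P base step p) ↝-impr
  FL-least P base step (fl-box p)  = step (FL-least P base step p) ↝-box
  FL-least P base step (fl-seq p)  = step (FL-least P base step p) ↝-seq
  FL-least P base step (fl-unl p)  = step (FL-least P base step p) ↝-unl
  FL-least P base step (fl-unr p)  = step (FL-least P base step p) ↝-unr
  FL-least P base step (fl-star p) = step (FL-least P base step p) ↝-star
  FL-least P base step (fl-tst1 p) = step (FL-least P base step p) ↝-tst1
  FL-least P base step (fl-tst2 p) = step (FL-least P base step p) ↝-tst2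

  -- closure φ lists (a superset of) FL(φ); unfold α ψ lists the boxes
  -- [β]χ obtained from [α]ψ by decomposing α, together with the closures
  -- of the tests occurring in α.
  mutual
    closure : Fm A → List (Fm A)
    closure (var p)   = var p ∷ []
    closure fals      = fals ∷ []
    closure (neg χ)   = neg χ ∷ closure χ
    closure (χ ⇒ θ)   = (χ ⇒ θ) ∷ closure χ ++ closure θ
    closure (box α ψ) = unfold α ψ ++ closure ψ

    unfold : Pg A → Fm A → List (Fm A)
    unfold (atom a) ψ = box (atom a) ψ ∷ []
    unfold (test θ) ψ = box (test θ) ψ ∷ closure θ
    unfold (α ⨾ β)  ψ = box (α ⨾ β) ψ ∷ unfold α (box β ψ) ++ unfold β ψ
    unfold (α ∪ β)  ψ = box (α ∪ β) ψ ∷ unfold α ψ ++ unfold β ψ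
    unfold (star α) ψ = box (star α) ψ ∷ unfold α (box (star α) ψ)

  box∈unfold : ∀ α ψ → box α ψ ∈ unfold α ψ
  box∈unfold (atom a) ψ = here refl
  box∈unfold (test θ) ψ = here refl
  box∈unfold (α ⨾ β)  ψ = here refl
  box∈unfold (α ∪ β)  ψ = here refl
  box∈unfold (star α) ψ = here refl

  φ∈closure : ∀ φ → φ ∈ closure φ
  φ∈closure (var p)   = here refl
  φ∈closure fals      = here refl
  φ∈closure (neg φ)   = here refl
  φ∈closure (φ ⇒ θ)   = here refl
  φ∈closure (box α φ) = ∈-++⁺ˡ (box∈unfold α φ)

  reassoc : ∀ {χ : Fm A} (xs ys zs : List (Fm A)) → χ ∈ xs ++ (ys ++ zs) → χ ∈ (xs ++ ys) ++ zs
  reassoc {χ} xs ys zs = subst (χ ∈_) (sym (++-assoc xs ys zs))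

  mutual
    closure-closed : ∀ φ {ψ χ} → ψ ∈ closure φ → ψ ↝ χ → χ ∈ closure φ
    closure-closed (var p) (here refl) ()
    closure-closed fals (here refl) ()
    closure-closed (neg χ) (here refl) ↝-neg = there (φ∈closure χ)
    closure-closed (neg χ) (there m) s = there (closure-closed χ m s)
    closure-closed (χ ⇒ θ) (here refl) ↝-impl = there (∈-++⁺ˡ (φ∈closure χ))
    closure-closed (χ ⇒ θ) (here refl) ↝-impr = there (∈-++⁺ʳ (closure χ) (φ∈closure θ))
    closure-closed (χ ⇒ θ) (there m) s with ∈-++⁻ (closure χ) m
    ... | inj₁ m′ = there (∈-++⁺ˡ (closure-closed χ m′ s))
    ... | inj₂ m′ = there (∈-++⁺ʳ (closure χ) (closure-closed θ m′ s))
    closure-closed (box α ψ) m s with ∈-++⁻ (unfold α ψ) m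
    ... | inj₁ m′ = unfold-closed α ψ m′ s
    ... | inj₂ m′ = ∈-++⁺ʳ (unfold α ψ) (closure-closed ψ m′ s)

    unfold-closed : ∀ α ψ {θ χ} → θ ∈ unfold α ψ → θ ↝ χ → χ ∈ closure (box α ψ)
    unfold-closed (atom a) ψ (here refl) ↝-box = ∈-++⁺ʳ _ (φ∈closure ψ)
    unfold-closed (test θ) ψ (here refl) ↝-box = ∈-++⁺ʳ _ (φ∈closure ψ)
    unfold-closed (test θ) ψ (here refl) ↝-tst1 = ∈-++⁺ˡ (there (φ∈closure θ))
    unfold-closed (test θ) ψ (here refl) ↝-tst2 = ∈-++⁺ʳ _ (φ∈closure ψ)
    unfold-closed (test θ) ψ (there m) s = ∈-++⁺ˡ (there (closure-closed θ m s))
    unfold-closed (α ⨾ β) ψ (here refl) ↝-box = ∈-++⁺ʳ _ (φ∈closure ψ)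
    unfold-closed (α ⨾ β) ψ (here refl) ↝-seq =
      ∈-++⁺ˡ (there (∈-++⁺ˡ (box∈unfold α (box β ψ))))
    unfold-closed (α ⨾ β) ψ (there m) s with ∈-++⁻ (unfold α (box β ψ)) m
    ... | inj₁ m′ = there (reassoc (unfold α (box β ψ)) (unfold β ψ) (closure ψ)
                              (unfold-closed α (box β ψ) m′ s))
    ... | inj₂ m′ = there (reassoc (unfold α (box β ψ)) (unfold β ψ) (closure ψ)
                              (∈-++⁺ʳ (unfold α (box β ψ)) (unfold-closed β ψ m′ s)))
    unfold-closed (α ∪ β) ψ (here refl) ↝-box = ∈-++⁺ʳ _ (φ∈closure ψ)
    unfold-closed (α ∪ β) ψ (here refl) ↝-unl = ∈-++⁺ˡ (there (∈-++⁺ˡ (box∈unfold α ψ)))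
    unfold-closed (α ∪ β) ψ (here refl) ↝-unr =
      ∈-++⁺ˡ (there (∈-++⁺ʳ (unfold α ψ) (box∈unfold β ψ)))
    unfold-closed (α ∪ β) ψ (there m) s with ∈-++⁻ (unfold α ψ) m
    ... | inj₁ m′ = there (++⁺ˡ (closure ψ) (xs⊆xs++ys (unfold α ψ) (unfold β ψ))
                              (unfold-closed α ψ m′ s))
    ... | inj₂ m′ = there (reassoc (unfold α ψ) (unfold β ψ) (closure ψ)
                              (∈-++⁺ʳ (unfold α ψ) (unfold-closed β ψ m′ s)))
    unfold-closed (star α) ψ (here refl) ↝-box = ∈-++⁺ʳ _ (φ∈closure ψ)
    unfold-closed (star α) ψ (here refl) ↝-star =
      ∈-++⁺ˡ (there (box∈unfold α (box (star α) ψ)))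
    unfold-closed (star α) ψ (there m) s
      with ∈-++⁻ (unfold α (box (star α) ψ)) (unfold-closed α (box (star α) ψ) m s)
    ... | inj₁ r = there (∈-++⁺ˡ r)
    ... | inj₂ r = r

  FL⊆closure : ∀ {φ ψ} → FL φ ψ → ψ ∈ closure φ
  FL⊆closure {φ} = FL-least (_∈ closure φ) (φ∈closure φ) (closure-closed φ)

division : ∀ N d → 1 ≤ d → d ≤ N → Σ ℕ λ q → 1 ≤ q × q * d ≤ N × N < q * d + d
division N d@(suc _) _ d≤N = N / d , m≥n⇒m/n>0 d≤N , m/n*n≤m N d , N<qd+d
  where
  N<qd+d : N < N / d * d + d
  N<qd+d = begin-strict
    N                 ≡⟨ m≡m%n+[m/n]*n N d ⟩
    N % d + N / d * d ≡⟨ +-comm (N % d) (N / d * d) ⟩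
    N / d * d + N % d <⟨ +-monoʳ-< (N / d * d) (m%n<n N d) ⟩
    N / d * d + d     ∎
    where open ≤-Reasoning

division-below : ∀ N r → 1 ≤ r → r < N → Σ ℕ λ q → 1 ≤ q × q * r < N × N ∸ q * r ≤ r
division-below (suc N) r 1≤r (s≤s r≤N) with division N r 1≤r r≤N
... | q , 1≤q , qr≤N , N<qr+r = q , 1≤q , s≤s qr≤N , m≤n+o⇒m∸n≤o (suc N) (q * r) N<qr+r

-- Arithmetic of the truth values {0,…,n} of the (n+1)-valued Łukasiewicz
-- chain, scaled by n: ¬a = n ∸ a and a → b = (n ∸ a + b) ⊓ n.
module ScaledChain (n : ℕ) where

  ∸-flip : ∀ {c d} → c ≤ n → d ≤ n → (c ≤ d) ⇔ (n ∸ d ≤ n ∸ c)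
  ∸-flip c≤n d≤n = mk⇔ (∸-monoʳ-≤ n) λ le →
    subst₂ _≤_ (m∸[m∸n]≡n c≤n) (m∸[m∸n]≡n d≤n) (∸-monoʳ-≤ n le)

  scale-≥ : ∀ m {k a} → 1 ≤ m → m * k ≤ n → (k ≤ a) ⇔ (m * k ≤ (m * a) ⊓ n)
  scale-≥ m@(suc _) {k} {a} _ mk≤n = mk⇔
    (λ k≤a → ⊓-glb (*-monoʳ-≤ m k≤a) mk≤n)
    (λ le → *-cancelˡ-≤ m (≤-trans le (m⊓n≤m (m * a) n)))

  scale-≤ : ∀ m {j a} → 1 ≤ m → m * j < n → (a ≤ j) ⇔ ((m * a) ⊓ n ≤ m * j)
  scale-≤ m@(suc _) {j} {a} _ mj<n = mk⇔
    (λ a≤j → ≤-trans (m⊓n≤m (m * a) n) (*-monoʳ-≤ m a≤j)) reflect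
    where
    reflect : (m * a) ⊓ n ≤ m * j → a ≤ j
    reflect le with a ≤? j
    ... | yes a≤j = a≤j
    ... | no a≰j = contradiction le (<⇒≱ (⊓-pres-m< (*-monoʳ-< m (≰⇒> a≰j)) mj<n))

  ⊓-absorb : ∀ a b → (a + b ⊓ n) ⊓ n ≡ (a + b) ⊓ n
  ⊓-absorb a b with ≤-total b n
  ... | inj₁ b≤n = cong (λ c → (a + c) ⊓ n) (m≤n⇒m⊓n≡m b≤n)
  ... | inj₂ n≤b = begin
    (a + b ⊓ n) ⊓ n ≡⟨ cong (λ c → (a + c) ⊓ n) (m≥n⇒m⊓n≡n n≤b) ⟩
    (a + n) ⊓ n     ≡⟨ m≥n⇒m⊓n≡n (m≤n+m n a) ⟩
    n               ≡⟨ m≥n⇒m⊓n≡n (≤-trans n≤b (m≤n+m b a)) ⟨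
    (a + b) ⊓ n     ∎
    where open ≡-Reasoning

  -- The Łukasiewicz term (a → b) → b computes the maximum of a and b.
  imp-imp≡⊔ : ∀ {a b} → a ≤ n → b ≤ n → (n ∸ ((n ∸ a + b) ⊓ n) + b) ⊓ n ≡ a ⊔ b
  imp-imp≡⊔ {a} {b} a≤n b≤n with ≤-total a b
  ... | inj₁ a≤b = begin
    (n ∸ ((n ∸ a + b) ⊓ n) + b) ⊓ n ≡⟨ cong (λ c → (n ∸ c + b) ⊓ n) (m≥n⇒m⊓n≡n n≤n∸a+b) ⟩
    (n ∸ n + b) ⊓ n                 ≡⟨ cong (λ c → (c + b) ⊓ n) (n∸n≡0 n) ⟩
    b ⊓ n                           ≡⟨ m≤n⇒m⊓n≡m b≤n ⟩
    b                               ≡⟨ m≤n⇒m⊔n≡n a≤b ⟨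
    a ⊔ b                           ∎
    where
    open ≡-Reasoning
    n≤n∸a+b : n ≤ n ∸ a + b
    n≤n∸a+b = subst (_≤ n ∸ a + b) (m∸n+n≡m a≤n) (+-monoʳ-≤ (n ∸ a) a≤b)
  ... | inj₂ b≤a = begin
    (n ∸ ((n ∸ a + b) ⊓ n) + b) ⊓ n ≡⟨ cong (λ c → (n ∸ c + b) ⊓ n) (m≤n⇒m⊓n≡m n∸a+b≤n) ⟩
    (n ∸ (n ∸ a + b) + b) ⊓ n       ≡⟨ cong (λ c → (c + b) ⊓ n) (∸-+-assoc n (n ∸ a) b) ⟨
    (n ∸ (n ∸ a) ∸ b + b) ⊓ n       ≡⟨ cong (λ c → (c ∸ b + b) ⊓ n) (m∸[m∸n]≡n a≤n) ⟩
    (a ∸ b + b) ⊓ n                 ≡⟨ cong (_⊓ n) (m∸n+n≡m b≤a) ⟩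
    a ⊓ n                           ≡⟨ m≤n⇒m⊓n≡m a≤n ⟩
    a                               ≡⟨ m≥n⇒m⊔n≡m b≤a ⟨
    a ⊔ b                           ∎
    where
    open ≡-Reasoning
    n∸a+b≤n : n ∸ a + b ≤ n
    n∸a+b≤n = subst (n ∸ a + b ≤_) (m∸n+n≡m a≤n) (+-monoʳ-≤ (n ∸ a) b≤a)

  ⊔≡top : ∀ {a b} → a ≤ n → b ≤ n → (a ⊔ b ≡ n) ⇔ (a ≡ n ⊎ b ≡ n)
  ⊔≡top {a} {b} a≤n b≤n = mk⇔ to from
    where
    to : a ⊔ b ≡ n → a ≡ n ⊎ b ≡ n
    to eq with ⊔-sel a b
    ... | inj₁ a⊔b≡a = inj₁ (trans (sym a⊔b≡a) eq)
    ... | inj₂ a⊔b≡b = inj₂ (trans (sym a⊔b≡b) eq)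
    from : a ≡ n ⊎ b ≡ n → a ⊔ b ≡ n
    from (inj₁ refl) = m≥n⇒m⊔n≡m b≤n
    from (inj₂ refl) = m≤n⇒m⊔n≡n a≤n

  ⊓≡top : ∀ {a b} → a ≤ n → b ≤ n → (a ⊓ b ≡ n) ⇔ (a ≡ n × b ≡ n)
  ⊓≡top {a} {b} a≤n b≤n = mk⇔
    (λ eq → ≤-antisym a≤n (subst (_≤ a) eq (m⊓n≤m a b)) ,
            ≤-antisym b≤n (subst (_≤ b) eq (m⊓n≤n a b)))
    (λ { (refl , refl) → ⊓-idem n })

module ⇔-Reasoning = Related.EquationalReasoning {k = Related.equivalence}

module Łukasiewicz {A : Set} (n : ℕ) (1≤n : 1 ≤ n) (M : Model A n) where
  open Model M
  open ScaledChain n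

  v : W → Fm A → ℕ
  v u x = toℕ (Val u x)

  v≤n : ∀ u x → v u x ≤ n
  v≤n u x = toℕ≤pred[n] (Val u x)

  -- x holds at u when it takes the designated value n, i.e. 1.
  Holds : W → Fm A → Set
  Holds u x = v u x ≡ n

  holds⇔top≤ : ∀ u x → Holds u x ⇔ (n ≤ v u x)
  holds⇔top≤ u x = mk⇔ (λ eq → ≤-reflexive (sym eq)) (≤-antisym (v≤n u x))

  v-fals : ∀ u → v u fals ≡ 0
  v-fals u = cong toℕ (val-0 u)

  fals-fails : ∀ u → ¬ Holds u fals
  fals-fails u eq = <⇒≢ 1≤n (trans (sym (v-fals u)) eq)

  ⊤ : Fm A
  ⊤ = neg fals

  ⊤-holds : ∀ u → Holds u ⊤
  ⊤-holds u = trans (val-neg u fals) (cong (n ∸_) (v-fals u))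

  _⊕_ : Fm A → Fm A → Fm A
  x ⊕ y = neg x ⇒ y

  v-⊕ : ∀ u x y → v u (x ⊕ y) ≡ (v u x + v u y) ⊓ n
  v-⊕ u x y = begin
    v u (neg x ⇒ y)                     ≡⟨ val-imp u (neg x) y ⟩
    (n ∸ v u (neg x) + v u y) ⊓ n       ≡⟨ cong (λ c → (n ∸ c + v u y) ⊓ n) (val-neg u x) ⟩
    (n ∸ (n ∸ v u x) + v u y) ⊓ n       ≡⟨ cong (λ c → (c + v u y) ⊓ n) (m∸[m∸n]≡n (v≤n u x)) ⟩
    (v u x + v u y) ⊓ n                 ∎
    where open ≡-Reasoning

  mul : ℕ → Fm A → Fm A
  mul zero    x = fals
  mul (suc m) x = x ⊕ mul m x

  v-mul : ∀ u m x → v u (mul m x) ≡ (m * v u x) ⊓ n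
  v-mul u zero    x = v-fals u
  v-mul u (suc m) x = begin
    v u (x ⊕ mul m x)                ≡⟨ v-⊕ u x (mul m x) ⟩
    (v u x + v u (mul m x)) ⊓ n      ≡⟨ cong (λ c → (v u x + c) ⊓ n) (v-mul u m x) ⟩
    (v u x + (m * v u x) ⊓ n) ⊓ n    ≡⟨ ⊓-absorb (v u x) (m * v u x) ⟩
    (suc m * v u x) ⊓ n              ∎
    where open ≡-Reasoning

  pw : ℕ → Fm A → Fm A
  pw m x = neg (mul m (neg x))

  v-pw : ∀ u m x → v u (pw m x) ≡ n ∸ (m * (n ∸ v u x)) ⊓ n
  v-pw u m x = trans (val-neg u (mul m (neg x)))
    (cong (n ∸_) (trans (v-mul u m (neg x)) (cong (λ c → (m * c) ⊓ n) (val-neg u x))))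

  _∨_ _∧_ : Fm A → Fm A → Fm A
  x ∨ y = (x ⇒ y) ⇒ y
  x ∧ y = neg (neg x ∨ neg y)

  v-∨ : ∀ u x y → v u (x ∨ y) ≡ v u x ⊔ v u y
  v-∨ u x y = begin
    v u ((x ⇒ y) ⇒ y)                              ≡⟨ val-imp u (x ⇒ y) y ⟩
    (n ∸ v u (x ⇒ y) + v u y) ⊓ n                  ≡⟨ cong (λ c → (n ∸ c + v u y) ⊓ n) (val-imp u x y) ⟩
    (n ∸ ((n ∸ v u x + v u y) ⊓ n) + v u y) ⊓ n    ≡⟨ imp-imp≡⊔ (v≤n u x) (v≤n u y) ⟩
    v u x ⊔ v u y                                  ∎
    where open ≡-Reasoning

  v-∧ : ∀ u x y → v u (x ∧ y) ≡ v u x ⊓ v u y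
  v-∧ u x y = begin
    v u (neg (neg x ∨ neg y))                      ≡⟨ val-neg u (neg x ∨ neg y) ⟩
    n ∸ v u (neg x ∨ neg y)                        ≡⟨ cong (n ∸_) (v-∨ u (neg x) (neg y)) ⟩
    n ∸ (v u (neg x) ⊔ v u (neg y))                ≡⟨ cong₂ (λ c d → n ∸ (c ⊔ d)) (val-neg u x) (val-neg u y) ⟩
    n ∸ ((n ∸ v u x) ⊔ (n ∸ v u y))                ≡⟨ ∸-distribˡ-⊔-⊓ n (n ∸ v u x) (n ∸ v u y) ⟩
    (n ∸ (n ∸ v u x)) ⊓ (n ∸ (n ∸ v u y))          ≡⟨ cong₂ _⊓_ (m∸[m∸n]≡n (v≤n u x)) (m∸[m∸n]≡n (v≤n u y)) ⟩
    v u x ⊓ v u y                                  ∎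
    where open ≡-Reasoning

  ∨-holds : ∀ u x y → Holds u (x ∨ y) ⇔ (Holds u x ⊎ Holds u y)
  ∨-holds u x y = begin
    Holds u (x ∨ y)          ≡⟨ cong (_≡ n) (v-∨ u x y) ⟩
    v u x ⊔ v u y ≡ n        ∼⟨ ⊔≡top (v≤n u x) (v≤n u y) ⟩
    (Holds u x ⊎ Holds u y)  ∎
    where open ⇔-Reasoning

  ∧-holds : ∀ u x y → Holds u (x ∧ y) ⇔ (Holds u x × Holds u y)
  ∧-holds u x y = begin
    Holds u (x ∧ y)          ≡⟨ cong (_≡ n) (v-∧ u x y) ⟩
    v u x ⊓ v u y ≡ n        ∼⟨ ⊓≡top (v≤n u x) (v≤n u y) ⟩
    (Holds u x × Holds u y)  ∎
    where open ⇔-Reasoning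

  Threshold : ℕ → (Fm A → Fm A) → Set
  Threshold k G = ∀ u x → Holds u (G x) ⇔ (k ≤ v u x)

  mul-threshold : ∀ m {k} → 1 ≤ m → m * k ≤ n → ∀ u x →
                  (k ≤ v u x) ⇔ (m * k ≤ v u (mul m x))
  mul-threshold m {k} 1≤m mk≤n u x = begin
    k ≤ v u x                ∼⟨ scale-≥ m 1≤m mk≤n ⟩
    m * k ≤ (m * v u x) ⊓ n  ≡⟨ cong (m * k ≤_) (sym (v-mul u m x)) ⟩
    m * k ≤ v u (mul m x)    ∎
    where open ⇔-Reasoning

  pw-threshold : ∀ m {j} → 1 ≤ m → m * j < n → ∀ u y →
                 (n ∸ j ≤ v u y) ⇔ (n ∸ m * j ≤ v u (pw m y))
  pw-threshold m@(suc _) {j} 1≤m mj<n u y = begin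
    n ∸ j ≤ b                          ∼⟨ ∸-flip (m∸n≤m n j) (v≤n u y) ⟩
    n ∸ b ≤ n ∸ (n ∸ j)                ≡⟨ cong (n ∸ b ≤_) (m∸[m∸n]≡n j≤n) ⟩
    n ∸ b ≤ j                          ∼⟨ scale-≤ m 1≤m mj<n ⟩
    (m * (n ∸ b)) ⊓ n ≤ m * j          ∼⟨ ∸-flip (m⊓n≤n _ n) (<⇒≤ mj<n) ⟩
    n ∸ m * j ≤ n ∸ (m * (n ∸ b)) ⊓ n  ≡⟨ cong (n ∸ m * j ≤_) (sym (v-pw u m y)) ⟩
    n ∸ m * j ≤ v u (pw m y)           ∎
    where
    open ⇔-Reasoning
    b = v u y
    j≤n : j ≤ n
    j≤n = <⇒≤ (≤-<-trans (m≤n*m j m) mj<n)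

  -- Write
  -- n = m * k + r with r < k.  If r = 0 then m·x defines the threshold.
  -- Otherwise k ≤ x ⟺ n ∸ r ≤ m·x ⟺ k′ ≤ pw m′ (m·x), where
  -- k′ = n ∸ m′ * r ≤ r < k comes from dividing n by r from below.
  threshold-step : ∀ k → 1 ≤ k → k ≤ n →
                   (∀ {j} → j < k → Σ (Fm A → Fm A) (Threshold j)) →
                   Σ (Fm A → Fm A) (Threshold k)
  threshold-step k@(suc _) 1≤k k≤n smaller with division n k 1≤k k≤n
  ... | m , 1≤m , mk≤n , n<mk+k with m * k ≟ n
  ...   | yes mk≡n = mul m , exact
    where
    exact : Threshold k (mul m)
    exact u x = ⇔-sym (begin
      k ≤ v u x              ∼⟨ mul-threshold m 1≤m mk≤n u x ⟩
      m * k ≤ v u (mul m x)  ≡⟨ cong (_≤ v u (mul m x)) mk≡n ⟩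
      n ≤ v u (mul m x)      ∼⟨ ⇔-sym (holds⇔top≤ u (mul m x)) ⟩
      Holds u (mul m x)      ∎)
      where open ⇔-Reasoning
  ...   | no mk≢n with division-below n (n ∸ m * k) 1≤r r<n
    where
    1≤r : 1 ≤ n ∸ m * k
    1≤r = m<n⇒0<n∸m (≤∧≢⇒< mk≤n mk≢n)
    r<n : n ∸ m * k < n
    r<n = ∸-monoʳ-< (*-mono-≤ 1≤m 1≤k) mk≤n
  ...     | m′ , 1≤m′ , m′r<n , k′≤r = G′ ∘ pw m′ ∘ mul m , reduced
    where
    r k′ : ℕ
    r = n ∸ m * k
    k′ = n ∸ m′ * r
    k′<k : k′ < k
    k′<k = ≤-<-trans k′≤r (m<n+o⇒m∸n<o n (m * k) n<mk+k)
    G′ : Fm A → Fm A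
    G′ = proj₁ (smaller k′<k)
    G′-threshold : Threshold k′ G′
    G′-threshold = proj₂ (smaller k′<k)
    reduced : Threshold k (G′ ∘ pw m′ ∘ mul m)
    reduced u x = begin
      Holds u (G′ (pw m′ y))      ∼⟨ G′-threshold u (pw m′ y) ⟩
      k′ ≤ v u (pw m′ y)          ∼⟨ ⇔-sym (pw-threshold m′ 1≤m′ m′r<n u y) ⟩
      n ∸ r ≤ v u y               ≡⟨ cong (_≤ v u y) (m∸[m∸n]≡n mk≤n) ⟩
      m * k ≤ v u y               ∼⟨ ⇔-sym (mul-threshold m 1≤m mk≤n u x) ⟩
      k ≤ v u x                   ∎
      where
      open ⇔-Reasoning
      y = mul m x

  threshold : ∀ k → Σ (Fm A → Fm A) (Threshold k)
  threshold = <-rec _ build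
    where
    build : ∀ k → (∀ {j} → j < k → Σ (Fm A → Fm A) (Threshold j)) →
            Σ (Fm A → Fm A) (Threshold k)
    build zero _ = const ⊤ , λ u x → mk⇔ (const z≤n) (const (⊤-holds u))
    build k@(suc _) smaller with k ≤? n
    ... | yes k≤n = threshold-step k (s≤s z≤n) k≤n smaller
    ... | no k≰n = const fals , λ u x →
      mk⇔ (λ h → contradiction h (fals-fails u))
          (λ k≤v → contradiction (≤-trans k≤v (v≤n u x)) k≰n)

  atLeast : ℕ → Fm A → Fm A
  atLeast k = proj₁ (threshold k)

  atLeast-holds : ∀ k → Threshold k (atLeast k)
  atLeast-holds k = proj₂ (threshold k)

  atMost : ℕ → Fm A → Fm A
  atMost j x = atLeast (n ∸ j) (neg x)

  atMost-holds : ∀ {j} u x → j ≤ n → Holds u (atMost j x) ⇔ (v u x ≤ j)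
  atMost-holds {j} u x j≤n = begin
    Holds u (atMost j x)   ∼⟨ atLeast-holds (n ∸ j) u (neg x) ⟩
    n ∸ j ≤ v u (neg x)    ≡⟨ cong (n ∸ j ≤_) (val-neg u x) ⟩
    n ∸ j ≤ n ∸ v u x      ∼⟨ ⇔-sym (∸-flip (v≤n u x) j≤n) ⟩
    v u x ≤ j              ∎
    where open ⇔-Reasoning

  hasValue : Fin (suc n) → Fm A → Fm A
  hasValue c x = atLeast (toℕ c) x ∧ atMost (toℕ c) x

  hasValue-holds : ∀ u c x → Holds u (hasValue c x) ⇔ (Val u x ≡ c)
  hasValue-holds u c x = begin
    Holds u (hasValue c x)          ∼⟨ ∧-holds u _ _ ⟩
    (Holds u (atLeast (toℕ c) x) × Holds u (atMost (toℕ c) x))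
                                    ∼⟨ atLeast-holds (toℕ c) u x ×-⇔ atMost-holds u x (toℕ≤pred[n] c) ⟩
    (toℕ c ≤ v u x × v u x ≤ toℕ c) ∼⟨ mk⇔ (λ (c≤v , v≤c) → toℕ-injective (≤-antisym v≤c c≤v))
                                          (λ { refl → ≤-refl , ≤-refl }) ⟩
    Val u x ≡ c                     ∎
    where open ⇔-Reasoning

  holds⇔top : ∀ u x → Holds u x ⇔ (Val u x ≡ fromℕ n)
  holds⇔top u x = mk⇔
    (λ h → toℕ-injective (trans h (sym (toℕ-fromℕ n))))
    (λ eq → trans (cong toℕ eq) (toℕ-fromℕ n))

  ⋁ : ∀ {k} → (Fin k → Fm A) → Fm A
  ⋁ {zero}  F = fals
  ⋁ {suc k} F = F zero ∨ ⋁ (F ∘ suc)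

  ⋁-holds : ∀ {k} u (F : Fin k → Fm A) → Holds u (⋁ F) ⇔ ∃ (λ i → Holds u (F i))
  ⋁-holds {zero}  u F = mk⇔ (λ h → contradiction h (fals-fails u)) (λ ())
  ⋁-holds {suc k} u F = mk⇔ to from
    where
    open Equivalence using () renaming (to to forth; from to back)
    to : Holds u (⋁ F) → ∃ (λ i → Holds u (F i))
    to h with forth (∨-holds u (F zero) (⋁ (F ∘ suc))) h
    ... | inj₁ h₀ = zero , h₀
    ... | inj₂ h′ with forth (⋁-holds u (F ∘ suc)) h′
    ...   | i , hᵢ = suc i , hᵢ
    from : ∃ (λ i → Holds u (F i)) → Holds u (⋁ F)
    from (zero , h)  = back (∨-holds u (F zero) (⋁ (F ∘ suc))) (inj₁ h)
    from (suc i , h) = back (∨-holds u (F zero) (⋁ (F ∘ suc)))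
                            (inj₂ (back (⋁-holds u (F ∘ suc)) (i , h)))

module Definability {A : Set} (n : ℕ) (1≤n : 1 ≤ n) (M : Model A n)
                    (em : ExcludedMiddle 0ℓ) where
  open Model M
  open Łukasiewicz n 1≤n M

  Agree : List (Fm A) → W → W → Set
  Agree L u w = ∀ {ψ} → ψ ∈ L → Val u ψ ≡ Val w ψ

  SaturatedFor : List (Fm A) → (W → Set) → Set
  SaturatedFor L E = ∀ {u w} → E u → Agree L u w → E w

  Defines : Fm A → (W → Set) → Set
  Defines Ψ E = ∀ u → E u ⇔ Holds u Ψ

  -- For L = [] all worlds agree, so E is empty or everything; deciding
  -- which of the two is the use of excluded middle.
  definable-[] : ∀ E → SaturatedFor [] E → Σ (Fm A) λ Ψ → Defines Ψ E
  definable-[] E sat with em {∃ E}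
  ... | yes (w , Ew) = ⊤ , λ u → mk⇔ (const (⊤-holds u)) (const (sat Ew (λ ())))
  ... | no ∄E = fals , λ u →
    mk⇔ (λ Eu → contradiction (u , Eu) ∄E) (λ h → contradiction h (fals-fails u))

  -- For ψ ∷ L, E is the union over the values c of ψ of the sets
  -- "ψ has value c" ∩ Part c, where Part c is the L-saturation of the
  -- part of E on which ψ has value c; each Part c is definable by induction.
  definable : ∀ L E → SaturatedFor L E → Σ (Fm A) λ Ψ → Defines Ψ E
  definable []      E sat = definable-[] E sat
  definable (ψ ∷ L) E sat = ⋁ (λ c → hasValue c ψ ∧ Ψ c) , defines
    where
    Part : Fin (suc n) → W → Set
    Part c u = ∃ λ w → E w × Val w ψ ≡ c × Agree L w u

    part-saturated : ∀ c → SaturatedFor L (Part c)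
    part-saturated c (w , Ew , ψc , w~u) u~u′ = w , Ew , ψc , λ m → trans (w~u m) (u~u′ m)

    Ψ : Fin (suc n) → Fm A
    Ψ c = proj₁ (definable L (Part c) (part-saturated c))

    Ψ-defines : ∀ c → Defines (Ψ c) (Part c)
    Ψ-defines c = proj₂ (definable L (Part c) (part-saturated c))

    split : ∀ u → E u ⇔ ∃ (λ c → Val u ψ ≡ c × Part c u)
    split u = mk⇔ (λ Eu → Val u ψ , refl , u , Eu , refl , (λ {_} _ → refl)) glue
      where
      glue : ∃ (λ c → Val u ψ ≡ c × Part c u) → E u
      glue (c , uc , w , Ew , wc , w~u) = sat Ew λ where
        (here refl) → trans wc (sym uc)
        (there m)   → w~u m

    defines : Defines (⋁ (λ c → hasValue c ψ ∧ Ψ c)) E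
    defines u = begin
      E u
        ∼⟨ split u ⟩
      ∃ (λ c → Val u ψ ≡ c × Part c u)
        ∼⟨ Σ.congˡ (⇔-sym (hasValue-holds u _ ψ) ×-⇔ Ψ-defines _ u) ⟩
      ∃ (λ c → Holds u (hasValue c ψ) × Holds u (Ψ c))
        ∼⟨ Σ.congˡ (⇔-sym (∧-holds u _ _)) ⟩
      ∃ (λ c → Holds u (hasValue c ψ ∧ Ψ c))
        ∼⟨ ⇔-sym (⋁-holds u _) ⟩
      Holds u (⋁ (λ c → hasValue c ψ ∧ Ψ c))
        ∎
      where open ⇔-Reasoning

lemmaA2 : ExcludedMiddle 0ℓ →
    (A : Set) → A → (n : ℕ) → 1 ≤ n → (M : Model A n) → (φ : Fm A) →
    (E : Model.W M → Set) → Model.Saturated M φ E →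
    Σ (Fm A) (λ Ψ → (u : Model.W M) → E u ⇔ (Model.Val M u Ψ ≡ fromℕ n))
lemmaA2 em A _ n 1≤n M φ E saturated = Ψ , λ u → begin
  E u                    ∼⟨ Ψ-defines u ⟩
  Holds u Ψ              ∼⟨ holds⇔top u Ψ ⟩
  Model.Val M u Ψ ≡ fromℕ n ∎
  where
  open Łukasiewicz n 1≤n M using (Holds; holds⇔top)
  open Definability n 1≤n M em using (SaturatedFor; Defines; definable)
  open FiniteClosure using (closure; FL⊆closure)
  open ⇔-Reasoning

  saturated-closure : SaturatedFor (closure φ) E
  saturated-closure Eu agree = saturated _ _ Eu (λ ψ fl → agree (FL⊆closure fl))

  Ψ : Fm A
  Ψ = proj₁ (definable (closure φ) E saturated-closure)

  Ψ-defines : Defines Ψ E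
  Ψ-defines = proj₂ (definable (closure φ) E saturated-closure)
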